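{- For every infinite binary word $w$, $\mathrm{PNF}_1(w)\ge_{\rm lex}\max(w)$ and $\mathrm{PNF}_0(w)\le_{\rm lex}\min(w)$.
   Context: Binary words are indexed from $1$; lexicographic order uses $0<1$. For an infinite binary word $w$, $\max(w)$ (resp. $\min(w)$) is the infinite word whose prefix of length $n$, for each $n\ge1$, is the lexicographically greatest (resp. smallest) factor of $w$ of length $n$. $F^1_w(i)$ (resp. $F^0_w(i)$) is the maximum number of $1$s (resp. $0$s) in a factor of $w$ of length $i$, with $F^a_w(0)=0$. The prefix normal forms are $\mathrm{PNF}_1(w)=w'$, $\mathrm{PNF}_0(w)=w''$ with $w'_n=F^1_w(n)-F^1_w(n-1)$ and $w''_n=1-(F^0_w(n)-F^0_w(n-1))$ for $n\ge1$. -}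

module Defs where

open import Data.Bool using (Bool; true; false)
open import Data.Nat using (ℕ; zero; suc; _+_; _∸_; _≤_; _<_)
open import Data.Product using (Σ; _×_)
open import Data.Sum using (_⊎_)
open import Data.Unit using (⊤)
open import Relation.Binary.PropositionalEquality using (_≡_)

-- An infinite binary word. Agda position k (0-based) is the paper's position k+1.
Word : Set
Word = ℕ → Bool

bit : Bool → ℕ
bit false = 0
bit true  = 1

Seq : Set
Seq = ℕ → ℕ

toSeq : Word → Seq
toSeq w k = bit (w k)

-- suffix of w starting at (0-based) position i; its prefix of length n is
-- the factor of w of length n starting at position i
suffix : Word → ℕ → Seq
suffix w i k = bit (w (i + k))

LexLeq : ℕ → Seq → Seq → Set
LexLeq zero    u v = ⊤
LexLeq (suc n) u v = (u 0 < v 0) ⊎ ((u 0 ≡ v 0) × LexLeq n (λ k → u (suc k)) (λ k → v (suc k)))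

_≤lex_ : Seq → Seq → Set
u ≤lex v = ∀ n → LexLeq n u v

PrefixIsFactor : Word → Word → ℕ → Set
PrefixIsFactor w m n = Σ ℕ λ i → ∀ k → k < n → m k ≡ w (i + k)

IsMax : Word → Word → Set
IsMax w m = ∀ n → PrefixIsFactor w m n × (∀ i → LexLeq n (suffix w i) (toSeq m))

IsMin : Word → Word → Set
IsMin w m = ∀ n → PrefixIsFactor w m n × (∀ i → LexLeq n (toSeq m) (suffix w i))

count : Bool → Word → ℕ → ℕ → ℕ
count a w i zero = 0
count a w i (suc n) = bitEq a (w i) + count a w (suc i) n
  where
  bitEq : Bool → Bool → ℕ
  bitEq true  true  = 1
  bitEq false false = 1
  bitEq _     _     = 0

IsF : Bool → Word → (ℕ → ℕ) → Set
IsF a w f = ∀ n → (Σ ℕ λ i → count a w i n ≡ f n) × (∀ i → count a w i n ≤ f n)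

-- PNF_1(w) computed from F^1_w (paper: w'_n = F^1(n) - F^1(n-1), n ≥ 1)
PNF₁ : (ℕ → ℕ) → Seq
PNF₁ f k = f (suc k) ∸ f k

-- PNF_0(w) computed from F^0_w (paper: w''_n = 1 - (F^0(n) - F^0(n-1)), n ≥ 1)
PNF₀ : (ℕ → ℕ) → Seq
PNF₀ g k = 1 ∸ (g (suc k) ∸ g k)

-- Write F for F^a_w. Every prefix of max(w) is a factor of w, so it contains at most F(n)
-- ones; the prefixes of PNF₁(w) contain exactly F(n) ones, since F has increments 0 or 1
-- and F(0) = 0. Domination of prefix sums forces lexicographic order: at the first
-- difference, the equal prefixes leave the next letter of max(w) the smaller one.
-- Dually, prefixes of min(w) contain at most F^0(n) zeros, hence at least n − F^0(n)
-- ones, which is exactly the number of ones in the prefix of PNF₀(w).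
module Submission where

open import Defs
open import Data.Bool using (true; false)
open import Data.Nat using (ℕ; zero; suc; _+_; _∸_; _≤_; _<_; z≤n; s≤s)
open import Data.Nat.Properties
open import Algebra.Properties.CommutativeSemigroup +-commutativeSemigroup using (interchange)
open import Data.Product using (_×_; _,_; proj₁; proj₂)
open import Data.Sum using (inj₁; inj₂)
open import Data.Unit using (tt)
open import Function using (_∘_)
open import Relation.Binary.PropositionalEquality

prefixSum : Seq → ℕ → ℕ
prefixSum u zero    = 0
prefixSum u (suc n) = u 0 + prefixSum (u ∘ suc) n

prefixSum-cong : ∀ {u v} → (∀ k → u k ≡ v k) → ∀ n → prefixSum u n ≡ prefixSum v n
prefixSum-cong u≗v zero    = refl
prefixSum-cong u≗v (suc n) = cong₂ _+_ (u≗v 0) (prefixSum-cong (u≗v ∘ suc) n)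

prefixSum-≤⇒≤lex : ∀ {u v} → (∀ n → prefixSum u n ≤ prefixSum v n) → u ≤lex v
prefixSum-≤⇒≤lex {u} {v} u≤v zero    = tt
prefixSum-≤⇒≤lex {u} {v} u≤v (suc n) with m≤n⇒m<n∨m≡n head≤
  where
  head≤ : u 0 ≤ v 0
  head≤ = subst₂ _≤_ (+-identityʳ (u 0)) (+-identityʳ (v 0)) (u≤v 1)
... | inj₁ u₀<v₀ = inj₁ u₀<v₀
... | inj₂ u₀≡v₀ = inj₂ (u₀≡v₀ , prefixSum-≤⇒≤lex tail≤ n)
  where
  tail≤ : ∀ m → prefixSum (u ∘ suc) m ≤ prefixSum (v ∘ suc) m
  tail≤ m = +-cancelˡ-≤ (v 0) _ _ (subst (λ x → x + _ ≤ _) u₀≡v₀ (u≤v (suc m)))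

prefixSum-PNF₁ : ∀ f → (∀ k → f k ≤ f (suc k)) → ∀ n → f 0 + prefixSum (PNF₁ f) n ≡ f n
prefixSum-PNF₁ f mono zero    = +-identityʳ (f 0)
prefixSum-PNF₁ f mono (suc n) = begin
  f 0 + ((f 1 ∸ f 0) + rest) ≡⟨ sym (+-assoc (f 0) _ _) ⟩
  f 0 + (f 1 ∸ f 0) + rest   ≡⟨ cong (_+ rest) (m+[n∸m]≡n (mono 0)) ⟩
  f 1 + rest                 ≡⟨ prefixSum-PNF₁ (f ∘ suc) (mono ∘ suc) n ⟩
  f (suc n)                  ∎
  where
  open ≡-Reasoning
  rest : ℕ
  rest = prefixSum (PNF₁ (f ∘ suc)) n

prefixSum-complement : ∀ {d} → (∀ k → d k ≤ 1) → ∀ n → prefixSum (λ k → 1 ∸ d k) n + prefixSum d n ≡ n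
prefixSum-complement d≤1 zero    = refl
prefixSum-complement {d} d≤1 (suc n) = begin
  (1 ∸ d 0) + prefixSum (λ k → 1 ∸ d (suc k)) n + (d 0 + prefixSum (d ∘ suc) n)
    ≡⟨ interchange (1 ∸ d 0) _ (d 0) _ ⟩
  (1 ∸ d 0) + d 0 + (prefixSum (λ k → 1 ∸ d (suc k)) n + prefixSum (d ∘ suc) n)
    ≡⟨ cong₂ _+_ (m∸n+n≡m (d≤1 0)) (prefixSum-complement (d≤1 ∘ suc) n) ⟩
  suc n ∎
  where open ≡-Reasoning

count-suc : ∀ a w i n → count a w i (suc n) ≡ count a w i 1 + count a w (suc i) n
count-suc true  w i n with w i
... | true  = refl
... | false = refl
count-suc false w i n with w i
... | true  = refl
... | false = refl

count-true-1 : ∀ w i → count true w i 1 ≡ bit (w i)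
count-true-1 w i with w i
... | true  = refl
... | false = refl

count-true≡prefixSum : ∀ w i n → count true w i n ≡ prefixSum (suffix w i) n
count-true≡prefixSum w i zero    = refl
count-true≡prefixSum w i (suc n) = begin
  count true w i (suc n)
    ≡⟨ count-suc true w i n ⟩
  count true w i 1 + count true w (suc i) n
    ≡⟨ cong₂ _+_ head (count-true≡prefixSum w (suc i) n) ⟩
  bit (w (i + 0)) + prefixSum (suffix w (suc i)) n
    ≡⟨ cong (_ +_) (prefixSum-cong (λ k → cong (bit ∘ w) (sym (+-suc i k))) n) ⟩
  prefixSum (suffix w i) (suc n)
    ∎
  where
  open ≡-Reasoning
  head : count true w i 1 ≡ bit (w (i + 0))
  head = trans (count-true-1 w i) (cong (bit ∘ w) (sym (+-identityʳ i)))

count-true+count-false : ∀ w i n → count true w i n + count false w i n ≡ n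
count-true+count-false w i zero    = refl
count-true+count-false w i (suc n) with w i
... | true  = cong suc (count-true+count-false w (suc i) n)
... | false = trans (+-suc _ _) (cong suc (count-true+count-false w (suc i) n))

count-≤-suc : ∀ a w i n → count a w i n ≤ count a w i (suc n)
count-≤-suc a w i zero    = z≤n
count-≤-suc a w i (suc n) = subst₂ _≤_ (sym (count-suc a w i n)) (sym (count-suc a w i (suc n)))
  (+-monoʳ-≤ (count a w i 1) (count-≤-suc a w (suc i) n))

count-suc-≤ : ∀ a w i n → count a w i (suc n) ≤ suc (count a w (suc i) n)
count-suc-≤ true  w i n with w i
... | true  = ≤-refl
... | false = n≤1+n _
count-suc-≤ false w i n with w i
... | true  = n≤1+n _
... | false = ≤-refl

count-1-cong : ∀ a {m w} s t → m s ≡ w t → count a m s 1 ≡ count a w t 1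
count-1-cong true  {m} {w} s t ms≡wt with m s | w t | ms≡wt
... | true  | .true  | refl = refl
... | false | .false | refl = refl
count-1-cong false {m} {w} s t ms≡wt with m s | w t | ms≡wt
... | true  | .true  | refl = refl
... | false | .false | refl = refl

count-window : ∀ a {m w} s t n → (∀ k → k < n → m (s + k) ≡ w (t + k)) → count a m s n ≡ count a w t n
count-window a s t zero    agree = refl
count-window a {m} {w} s t (suc n) agree = begin
  count a m s (suc n)
    ≡⟨ count-suc a m s n ⟩
  count a m s 1 + count a m (suc s) n
    ≡⟨ cong₂ _+_ (count-1-cong a {m} {w} s t head) (count-window a {m} {w} (suc s) (suc t) n tail) ⟩
  count a w t 1 + count a w (suc t) n
    ≡⟨ sym (count-suc a w t n) ⟩
  count a w t (suc n)
    ∎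
  where
  open ≡-Reasoning
  head : m s ≡ w t
  head = subst₂ (λ x y → m x ≡ w y) (+-identityʳ s) (+-identityʳ t) (agree 0 (s≤s z≤n))
  tail : ∀ k → k < n → m (suc s + k) ≡ w (suc t + k)
  tail k k<n = subst₂ (λ x y → m x ≡ w y) (+-suc s k) (+-suc t k) (agree (suc k) (s≤s k<n))

module _ {a w f} (isF : IsF a w f) where

  IsF-zero : f 0 ≡ 0
  IsF-zero = sym (proj₂ (proj₁ (isF 0)))

  IsF-mono : ∀ n → f n ≤ f (suc n)
  IsF-mono n with proj₁ (isF n)
  ... | i , count≡f = subst (_≤ f (suc n)) count≡f (≤-trans (count-≤-suc a w i n) (proj₂ (isF (suc n)) i))

  IsF-step : ∀ n → f (suc n) ≤ suc (f n)
  IsF-step n with proj₁ (isF (suc n))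
  ... | i , count≡f = subst (_≤ suc (f n)) count≡f (≤-trans (count-suc-≤ a w i n) (s≤s (proj₂ (isF n) (suc i))))

  PNF₁-≤1 : ∀ n → PNF₁ f n ≤ 1
  PNF₁-≤1 n = m≤n+o⇒m∸n≤o (f (suc n)) (f n) (subst (f (suc n) ≤_) (+-comm 1 (f n)) (IsF-step n))

  prefixSum-PNF₁≡ : ∀ n → prefixSum (PNF₁ f) n ≡ f n
  prefixSum-PNF₁≡ n = subst (λ x → x + prefixSum (PNF₁ f) n ≡ f n) IsF-zero (prefixSum-PNF₁ f IsF-mono n)

  count-prefix-≤ : ∀ {m} n → PrefixIsFactor w m n → count a m 0 n ≤ f n
  count-prefix-≤ n (i , agree) = subst (_≤ f n) (sym (count-window a 0 i n agree)) (proj₂ (isF n) i)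

toSeq-≤lex-PNF₁ : ∀ {w m f} → IsF true w f → (∀ n → PrefixIsFactor w m n) → toSeq m ≤lex PNF₁ f
toSeq-≤lex-PNF₁ {w} {m} {f} isF factor = prefixSum-≤⇒≤lex λ n → begin
  prefixSum (toSeq m) n  ≡⟨ sym (count-true≡prefixSum m 0 n) ⟩
  count true m 0 n       ≤⟨ count-prefix-≤ isF n (factor n) ⟩
  f n                    ≡⟨ sym (prefixSum-PNF₁≡ isF n) ⟩
  prefixSum (PNF₁ f) n   ∎
  where open ≤-Reasoning

PNF₀-≤lex-toSeq : ∀ {w m g} → IsF false w g → (∀ n → PrefixIsFactor w m n) → PNF₀ g ≤lex toSeq m
PNF₀-≤lex-toSeq {w} {m} {g} isF factor = prefixSum-≤⇒≤lex λ n →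
  +-cancelʳ-≤ (g n) _ _ (begin
    prefixSum (PNF₀ g) n + g n                   ≡⟨ cong (prefixSum (PNF₀ g) n +_) (sym (prefixSum-PNF₁≡ isF n)) ⟩
    prefixSum (PNF₀ g) n + prefixSum (PNF₁ g) n  ≡⟨ prefixSum-complement (PNF₁-≤1 isF) n ⟩
    n                                            ≡⟨ sym (count-true+count-false m 0 n) ⟩
    count true m 0 n + count false m 0 n         ≤⟨ +-monoʳ-≤ _ (count-prefix-≤ isF n (factor n)) ⟩
    count true m 0 n + g n                       ≡⟨ cong (_+ g n) (count-true≡prefixSum m 0 n) ⟩
    prefixSum (toSeq m) n + g n                  ∎)
  where open ≤-Reasoning

lemma12 : (w mx mn : Word) (f₁ f₀ : ℕ → ℕ) →
    IsMax w mx → IsMin w mn → IsF true w f₁ → IsF false w f₀ →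
    (toSeq mx ≤lex PNF₁ f₁) × (PNF₀ f₀ ≤lex toSeq mn)
lemma12 w mx mn f₁ f₀ isMax isMin isF₁ isF₀ =
  toSeq-≤lex-PNF₁ isF₁ (proj₁ ∘ isMax) , PNF₀-≤lex-toSeq isF₀ (proj₁ ∘ isMin)
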